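{- Let $(\mathcal{T}_r)_{r\in\mathbb{Z}}$ be a sequence of complex numbers satisfying $\mathcal{T}_r=\mathcal{T}_{r-1}+\mathcal{T}_{r-2}+\mathcal{T}_{r-3}$ for all integers $r$. Then for every non-negative integer $k$: \[ \begin{aligned} 8\sum_{j=0}^k j^2\mathcal{T}_j^2 &= (9k^2-4k+6)\mathcal{T}_k^2 + (7k^2-14k+7)\mathcal{T}_{k-1}^2 + (4k^2-16k+10)\mathcal{T}_{k-2}^2 - (2k^2+6)\mathcal{T}_{k-3}^2\\ &\quad - (k^2+2)\mathcal{T}_{k-4}^2 - (k^2-2k+3)\mathcal{T}_{k-5}^2\\ &\quad - 19\mathcal{T}_{ -1}^2 - 28\mathcal{T}_{ -2}^2 - 30\mathcal{T}_{ -3}^2 + 8\mathcal{T}_{ -4}^2 + 3\mathcal{T}_{ -5}^2 + 6\mathcal{T}_{ -6}^2 . \end{aligned} \]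
   Context: A generalized Tribonacci sequence is determined by arbitrary initial values $\mathcal{T}_0,\mathcal{T}_1,\mathcal{T}_2$ and the recurrence $\mathcal{T}_r=\mathcal{T}_{r-1}+\mathcal{T}_{r-2}+\mathcal{T}_{r-3}$, extended to all integer indices. -}

module Defs where

open import Level using (Level)
open import Algebra.Bundles using (CommutativeRing)
open import Data.Nat using (ℕ; zero; suc)
open import Data.Integer as ℤ using (ℤ; +_)

module _ {c ℓ : Level} (R : CommutativeRing c ℓ) where
  open CommutativeRing R

  nat : ℕ → Carrier
  nat zero    = 0#
  nat (suc n) = 1# + nat n

  IsTribonacci : (ℤ → Carrier) → Set ℓ
  IsTribonacci T = ∀ r → T r ≈ T (r ℤ.- + 1) + T (r ℤ.- + 2) + T (r ℤ.- + 3)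

  sumSqWeighted : (ℤ → Carrier) → ℕ → Carrier
  sumSqWeighted T zero    = nat 0 * nat 0 * (T (+ 0) * T (+ 0))
  sumSqWeighted T (suc k) = sumSqWeighted T k + nat (suc k) * nat (suc k) * (T (+ suc k) * T (+ suc k))

-- Put Φ(a) = Σ_{i<6} c_i(a) T_{a-i}², the quadratic form in the last six terms whose coefficients
-- c_i are the polynomials of the right-hand side.  For every integer a,
--   Φ(a+1) = Φ(a) + 8 (a+1)² T_{a+1}²,
-- a polynomial identity in a and the three terms T_{a+1}, T_a, T_{a-1} once the recurrence,
-- run backwards, expresses T_{a-2}, …, T_{a-5} through them.  Summing from a = -1 gives
-- 8 Σ_{j≤k} j² T_j² = Φ(k) - Φ(-1), and the constant tail of the formula is exactly -Φ(-1).
module Submission where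

open import Defs
open import Level using (Level; 0ℓ)
open import Algebra.Bundles using (CommutativeRing; RawRing)
open import Algebra.Solver.Ring.AlmostCommutativeRing
  using (fromCommutativeRing; _-Raw-AlmostCommutative⟶_)
open import Data.Nat as ℕ using (ℕ; zero; suc)
import Data.Nat.Properties as ℕP
open import Data.Integer as ℤ using (ℤ; +_; -[1+_])
import Data.Integer.Properties as ℤP
open import Data.Integer.Tactic.RingSolver using (solve-∀)
open import Data.Fin as Fin using (Fin; toℕ)
open import Data.Fin.Patterns using (0F; 1F; 2F; 3F; 4F; 5F)
open import Data.Maybe using (Maybe; map)
open import Data.Vec using (Vec; []; _∷_; lookup)
open import Data.Vec.Relation.Binary.Pointwise.Inductive as Pointwise
  using (Pointwise; []; _∷_)
open import Function using (_∘_)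
open import Relation.Binary.Consequences using (dec⇒weaklyDec)
open import Relation.Binary.PropositionalEquality as ≡ using (_≡_)

-- back a j = a - j, but with back a 0 = a on the nose, as the statement writes T (+ k), not T (+ k - + 0).
back : ℤ → ℕ → ℤ
back a zero    = a
back a (suc j) = a ℤ.- + suc j

sub-sub : ∀ a m n → a ℤ.- m ℤ.- n ≡ a ℤ.- (m ℤ.+ n)
sub-sub = solve-∀

back-sub : ∀ a j i → back a j ℤ.- + suc i ≡ back a (suc i ℕ.+ j)
back-sub a zero    i = ≡.cong (λ n → a ℤ.- + n) (≡.sym (ℕP.+-identityʳ (suc i)))
back-sub a (suc j) i =
  ≡.trans (sub-sub a (+ suc j) (+ suc i)) (≡.cong (λ n → a ℤ.- + n) (ℕP.+-comm (suc j) (suc i)))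

back-suc : ∀ a j → back (+ 1 ℤ.+ a) (suc j) ≡ back a j
back-suc a zero    = cancel a
  where
  cancel : ∀ a → (+ 1 ℤ.+ a) ℤ.- + 1 ≡ a
  cancel = solve-∀
back-suc a (suc j) = cancel a (+ suc j)
  where
  cancel : ∀ a m → (+ 1 ℤ.+ a) ℤ.- (+ 1 ℤ.+ m) ≡ a ℤ.- m
  cancel = solve-∀

-- Written once over an arbitrary raw ring with numerals: instantiated with the ring itself and
-- with the solver's syntax, the two versions evaluate to definitionally equal terms.
module Forms {a ℓ} (A : RawRing a ℓ) (num : ℕ → RawRing.Carrier A) where

  open RawRing A

  infixl 6 _-_
  _-_ : Carrier → Carrier → Carrier
  x - y = x + - y

  weightedSquares : Carrier → (Fin 6 → Carrier) → Carrier
  weightedSquares K t =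
    (num 9 * K * K - num 4 * K + num 6) * sq 0F
    + (num 7 * K * K - num 14 * K + num 7) * sq 1F
    + (num 4 * K * K - num 16 * K + num 10) * sq 2F
    - (num 2 * K * K + num 6) * sq 3F
    - (K * K + num 2) * sq 4F
    - (K * K - num 2 * K + num 3) * sq 5F
    where
    sq : Fin 6 → Carrier
    sq i = t i * t i

  reversedTribonacci : Carrier → Carrier → Carrier → ℕ → Carrier
  reversedTribonacci x y z 0 = x
  reversedTribonacci x y z 1 = y
  reversedTribonacci x y z 2 = z
  reversedTribonacci x y z (suc (suc (suc j))) =
    reversedTribonacci x y z j - reversedTribonacci x y z (suc j) - reversedTribonacci x y z (suc (suc j))

module IntegerCoefficients {c ℓ} (R : CommutativeRing c ℓ) where

  open CommutativeRing R
  open import Algebra.Properties.Ring ring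
    using (-0#≈0#; -‿involutive; -‿+-comm; -‿distribˡ-*; -‿distribʳ-*)
  import Algebra.Properties.CommutativeSemigroup +-commutativeSemigroup as +-Properties
  open import Relation.Binary.Reasoning.Setoid setoid

  fromℤ : ℤ → Carrier
  fromℤ (+ n)    = nat R n
  fromℤ -[1+ n ] = - nat R (suc n)

  nat-+ : ∀ m n → nat R (m ℕ.+ n) ≈ nat R m + nat R n
  nat-+ zero    n = sym (+-identityˡ _)
  nat-+ (suc m) n = trans (+-congˡ (nat-+ m n)) (sym (+-assoc _ _ _))

  nat-* : ∀ m n → nat R (m ℕ.* n) ≈ nat R m * nat R n
  nat-* zero    n = sym (zeroˡ _)
  nat-* (suc m) n = begin
    nat R (n ℕ.+ m ℕ.* n)          ≈⟨ nat-+ n (m ℕ.* n) ⟩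
    nat R n + nat R (m ℕ.* n)      ≈⟨ +-cong (sym (*-identityˡ _)) (nat-* m n) ⟩
    1# * nat R n + nat R m * nat R n  ≈⟨ distribʳ _ _ _ ⟨
    (1# + nat R m) * nat R n        ∎

  sub-cancel-1 : ∀ x y → (1# + x) - (1# + y) ≈ x - y
  sub-cancel-1 x y = begin
    (1# + x) + - (1# + y)      ≈⟨ +-congˡ (-‿+-comm 1# y) ⟨
    (1# + x) + (- 1# + - y)    ≈⟨ +-Properties.interchange 1# x (- 1#) (- y) ⟩
    (1# + - 1#) + (x + - y)    ≈⟨ +-congʳ (-‿inverseʳ 1#) ⟩
    0# + (x - y)               ≈⟨ +-identityˡ _ ⟩
    x - y                      ∎

  fromℤ-⊖ : ∀ m n → fromℤ (m ℤ.⊖ n) ≈ nat R m - nat R n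
  fromℤ-⊖ zero    zero    = sym (-‿inverseʳ 0#)
  fromℤ-⊖ (suc m) zero    = sym (trans (+-congˡ -0#≈0#) (+-identityʳ _))
  fromℤ-⊖ zero    (suc n) = sym (+-identityˡ _)
  fromℤ-⊖ (suc m) (suc n) rewrite ℤP.[1+m]⊖[1+n]≡m⊖n m n =
    trans (fromℤ-⊖ m n) (sym (sub-cancel-1 (nat R m) (nat R n)))

  fromℤ-+ : ∀ i j → fromℤ (i ℤ.+ j) ≈ fromℤ i + fromℤ j
  fromℤ-+ (+ m)    (+ n)    = nat-+ m n
  fromℤ-+ (+ m)    -[1+ n ] = fromℤ-⊖ m (suc n)
  fromℤ-+ -[1+ m ] (+ n)    = trans (fromℤ-⊖ n (suc m)) (+-comm _ _)
  fromℤ-+ -[1+ m ] -[1+ n ] = begin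
    - nat R (suc (suc (m ℕ.+ n)))          ≡⟨ ≡.cong (-_ ∘ nat R ∘ suc) (ℕP.+-suc m n) ⟨
    - nat R (suc m ℕ.+ suc n)              ≈⟨ -‿cong (nat-+ (suc m) (suc n)) ⟩
    - (nat R (suc m) + nat R (suc n))      ≈⟨ -‿+-comm _ _ ⟨
    - nat R (suc m) + - nat R (suc n)      ∎

  fromℤ-neg : ∀ i → fromℤ (ℤ.- i) ≈ - fromℤ i
  fromℤ-neg (+ zero)  = sym -0#≈0#
  fromℤ-neg (+ suc n) = refl
  fromℤ-neg -[1+ n ]  = sym (-‿involutive _)

  fromℤ-*-pos : ∀ i n → fromℤ (i ℤ.* + n) ≈ fromℤ i * nat R n
  fromℤ-*-pos (+ m)    n rewrite ≡.sym (ℤP.pos-* m n) = nat-* m n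
  fromℤ-*-pos -[1+ m ] n rewrite ≡.sym (ℤP.neg-distribˡ-* (+ suc m) (+ n)) = begin
    fromℤ (ℤ.- (+ suc m ℤ.* + n))      ≈⟨ fromℤ-neg (+ suc m ℤ.* + n) ⟩
    - fromℤ (+ suc m ℤ.* + n)          ≈⟨ -‿cong (fromℤ-*-pos (+ suc m) n) ⟩
    - (nat R (suc m) * nat R n)        ≈⟨ -‿distribˡ-* _ _ ⟩
    - nat R (suc m) * nat R n          ∎

  fromℤ-* : ∀ i j → fromℤ (i ℤ.* j) ≈ fromℤ i * fromℤ j
  fromℤ-* i (+ n)    = fromℤ-*-pos i n
  fromℤ-* i -[1+ n ] rewrite ≡.sym (ℤP.neg-distribʳ-* i (+ suc n)) = begin
    fromℤ (ℤ.- (i ℤ.* + suc n))        ≈⟨ fromℤ-neg (i ℤ.* + suc n) ⟩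
    - fromℤ (i ℤ.* + suc n)            ≈⟨ -‿cong (fromℤ-*-pos i (suc n)) ⟩
    - (fromℤ i * nat R (suc n))        ≈⟨ -‿distribʳ-* _ _ ⟩
    fromℤ i * - nat R (suc n)          ∎

  fromℤ-homomorphism : ℤ.+-*-rawRing -Raw-AlmostCommutative⟶ fromCommutativeRing R
  fromℤ-homomorphism = record
    { ⟦_⟧    = fromℤ
    ; +-homo = fromℤ-+
    ; *-homo = fromℤ-*
    ; -‿homo = fromℤ-neg
    ; 0-homo = refl
    ; 1-homo = +-identityʳ 1#
    }

  fromℤ-≟ : ∀ i j → Maybe (fromℤ i ≈ fromℤ j)
  fromℤ-≟ i j = map (reflexive ∘ ≡.cong fromℤ) (dec⇒weaklyDec ℤ._≟_ i j)

  open import Algebra.Solver.Ring ℤ.+-*-rawRing (fromCommutativeRing R) fromℤ-homomorphism fromℤ-≟ public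

  polynomials : ℕ → RawRing 0ℓ 0ℓ
  polynomials n = record
    { Carrier = Polynomial n
    ; _≈_     = _≡_
    ; _+_     = _:+_
    ; _*_     = _:*_
    ; -_      = :-_
    ; 0#      = con (+ 0)
    ; 1#      = con (+ 1)
    }

  open import Algebra.Properties.Semiring.Exp semiring using (^-congˡ)

  ⟦⟧-cong : ∀ {n} (p : Polynomial n) {ρ ρ′ : Vec Carrier n} →
            Pointwise _≈_ ρ ρ′ → ⟦ p ⟧ ρ ≈ ⟦ p ⟧ ρ′
  ⟦⟧-cong (op [+] p q) ρ≈ρ′ = +-cong (⟦⟧-cong p ρ≈ρ′) (⟦⟧-cong q ρ≈ρ′)
  ⟦⟧-cong (op [*] p q) ρ≈ρ′ = *-cong (⟦⟧-cong p ρ≈ρ′) (⟦⟧-cong q ρ≈ρ′)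
  ⟦⟧-cong (con c)      ρ≈ρ′ = refl
  ⟦⟧-cong (var x)      ρ≈ρ′ = Pointwise.lookup ρ≈ρ′ x
  ⟦⟧-cong (p :^ n)     ρ≈ρ′ = ^-congˡ n (⟦⟧-cong p ρ≈ρ′)
  ⟦⟧-cong (:- p)       ρ≈ρ′ = -‿cong (⟦⟧-cong p ρ≈ρ′)

module _ {c ℓ} (R : CommutativeRing c ℓ) where

  open CommutativeRing R
  open IntegerCoefficients R
  open import Algebra.Properties.Ring ring using (xyx⁻¹≈y)
  open import Relation.Binary.Reasoning.Setoid setoid

  open Forms rawRing (nat R) using (weightedSquares; reversedTribonacci)

  private
    module Syntax {n} = Forms (polynomials n) (λ m → con (+ m))

  weightedSquares-cong : ∀ {K K′ t t′} → K ≈ K′ → (∀ i → t i ≈ t′ i) →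
                         weightedSquares K t ≈ weightedSquares K′ t′
  weightedSquares-cong K≈K′ t≈t′ =
    ⟦⟧-cong (Syntax.weightedSquares (var 0F) (var ∘ Fin.suc)) (K≈K′ ∷ Pointwise.tabulate⁺ t≈t′)

  weightedSquares-step-reversedTribonacci : ∀ K x y z →
    let r = reversedTribonacci x y z in
    weightedSquares (nat R 1 + K) (r ∘ toℕ)
      ≈ weightedSquares K (r ∘ suc ∘ toℕ) + nat R 8 * ((nat R 1 + K) * (nat R 1 + K) * (x * x))
  weightedSquares-step-reversedTribonacci = solve 4 (λ K x y z →
    let r = Syntax.reversedTribonacci x y z in
    Syntax.weightedSquares (con (+ 1) :+ K) (r ∘ toℕ)
      := Syntax.weightedSquares K (r ∘ suc ∘ toℕ) :+ con (+ 8) :* ((con (+ 1) :+ K) :* (con (+ 1) :+ K) :* (x :* x)))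
    refl

  weightedSquares-at-minus-one : ∀ X t₁ t₂ t₃ t₄ t₅ t₆ →
    X - nat R 19 * (t₁ * t₁) - nat R 28 * (t₂ * t₂) - nat R 30 * (t₃ * t₃)
      + nat R 8 * (t₄ * t₄) + nat R 3 * (t₅ * t₅) + nat R 6 * (t₆ * t₆)
      ≈ X - weightedSquares (- nat R 1) (lookup (t₁ ∷ t₂ ∷ t₃ ∷ t₄ ∷ t₅ ∷ t₆ ∷ []))
  weightedSquares-at-minus-one = solve 7 (λ X t₁ t₂ t₃ t₄ t₅ t₆ →
    X :- con (+ 19) :* (t₁ :* t₁) :- con (+ 28) :* (t₂ :* t₂) :- con (+ 30) :* (t₃ :* t₃)
      :+ con (+ 8) :* (t₄ :* t₄) :+ con (+ 3) :* (t₅ :* t₅) :+ con (+ 6) :* (t₆ :* t₆)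
      := X :- Syntax.weightedSquares (:- con (+ 1)) (lookup (t₁ ∷ t₂ ∷ t₃ ∷ t₄ ∷ t₅ ∷ t₆ ∷ [])))
    refl

  IsReversedTribonacci : (ℕ → Carrier) → Set ℓ
  IsReversedTribonacci s = ∀ j → s j ≈ s (suc j) + s (suc (suc j)) + s (suc (suc (suc j)))

  reversed≈reversedTribonacci : ∀ {s} → IsReversedTribonacci s →
                                ∀ j → s j ≈ reversedTribonacci (s 0) (s 1) (s 2) j
  reversed≈reversedTribonacci {s} rec 0 = refl
  reversed≈reversedTribonacci {s} rec 1 = refl
  reversed≈reversedTribonacci {s} rec 2 = refl
  reversed≈reversedTribonacci {s} rec (suc j₂@(suc j₁@(suc j))) = begin
    s (suc j₂)                 ≈⟨ isolate (s j₁) (s j₂) (s (suc j₂)) ⟨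
    s j₁ + s j₂ + s (suc j₂) - s j₁ - s j₂
                               ≈⟨ +-congʳ (+-congʳ (rec j)) ⟨
    s j - s j₁ - s j₂          ≈⟨ +-cong (+-cong (reversed≈reversedTribonacci rec j)
                                                 (-‿cong (reversed≈reversedTribonacci rec j₁)))
                                         (-‿cong (reversed≈reversedTribonacci rec j₂)) ⟩
    r j - r j₁ - r j₂          ∎
    where
    r = reversedTribonacci (s 0) (s 1) (s 2)
    isolate : ∀ a b c → a + b + c - a - b ≈ c
    isolate = solve 3 (λ a b c → a :+ b :+ c :- a :- b := c) refl

  weightedSquares-step : ∀ {s} → IsReversedTribonacci s → ∀ {K K′} → K′ ≈ nat R 1 + K →
    weightedSquares K′ (s ∘ toℕ)
      ≈ weightedSquares K (s ∘ suc ∘ toℕ) + nat R 8 * (K′ * K′ * (s 0 * s 0))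
  weightedSquares-step {s} rec {K} {K′} K′≈1+K = begin
    weightedSquares K′ (s ∘ toℕ)
      ≈⟨ weightedSquares-cong K′≈1+K (s≈r ∘ toℕ) ⟩
    weightedSquares (nat R 1 + K) (r ∘ toℕ)
      ≈⟨ weightedSquares-step-reversedTribonacci K (s 0) (s 1) (s 2) ⟩
    weightedSquares K (r ∘ suc ∘ toℕ) + nat R 8 * ((nat R 1 + K) * (nat R 1 + K) * (s 0 * s 0))
      ≈⟨ +-cong (weightedSquares-cong refl (sym ∘ s≈r ∘ suc ∘ toℕ))
                (*-congˡ (*-congʳ (*-cong (sym K′≈1+K) (sym K′≈1+K)))) ⟩
    weightedSquares K (s ∘ suc ∘ toℕ) + nat R 8 * (K′ * K′ * (s 0 * s 0))
      ∎
    where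
    r = reversedTribonacci (s 0) (s 1) (s 2)
    s≈r = reversed≈reversedTribonacci rec

  telescoping : ∀ (T : ℤ → Carrier) {a d} {f : ℕ → Carrier} →
    f 0 ≈ d + a * sumSqWeighted R T 0 →
    (∀ k → f (suc k) ≈ f k + a * (nat R (suc k) * nat R (suc k) * (T (+ suc k) * T (+ suc k)))) →
    ∀ k → a * sumSqWeighted R T k ≈ f k - d
  telescoping T {a} {d} {f} base step k = begin
    a * sumSqWeighted R T k          ≈⟨ xyx⁻¹≈y d _ ⟨
    d + a * sumSqWeighted R T k - d  ≈⟨ +-congʳ (partial k) ⟩
    f k - d                          ∎
    where
    partial : ∀ k → d + a * sumSqWeighted R T k ≈ f k
    partial zero    = sym base
    partial (suc k) = begin
      d + a * (sumSqWeighted R T k + t)        ≈⟨ +-congˡ (distribˡ a _ _) ⟩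
      d + (a * sumSqWeighted R T k + a * t)    ≈⟨ +-assoc _ _ _ ⟨
      d + a * sumSqWeighted R T k + a * t      ≈⟨ +-congʳ (partial k) ⟩
      f k + a * t                              ≈⟨ step k ⟨
      f (suc k)                                ∎
      where t = nat R (suc k) * nat R (suc k) * (T (+ suc k) * T (+ suc k))

  module _ (T : ℤ → Carrier) where

    window : ℤ → ℕ → Carrier
    window a j = T (back a j)

    window-reversed : IsTribonacci R T → ∀ a → IsReversedTribonacci (window a)
    window-reversed tribonacci a j = trans (tribonacci (back a j))
      (+-cong (+-cong (T-cong (back-sub a j 0)) (T-cong (back-sub a j 1))) (T-cong (back-sub a j 2)))
      where
      T-cong : ∀ {i i′} → i ≡ i′ → T i ≈ T i′
      T-cong = reflexive ∘ ≡.cong T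

    potential : ℤ → Carrier
    potential a = weightedSquares (fromℤ a) (window a ∘ toℕ)

    potential-step : IsTribonacci R T → ∀ a → potential (+ 1 ℤ.+ a)
      ≈ potential a + nat R 8 * (fromℤ (+ 1 ℤ.+ a) * fromℤ (+ 1 ℤ.+ a) * (T (+ 1 ℤ.+ a) * T (+ 1 ℤ.+ a)))
    potential-step tribonacci a =
      trans (weightedSquares-step (window-reversed tribonacci (+ 1 ℤ.+ a)) (fromℤ-+ (+ 1) a))
            (+-congʳ (weightedSquares-cong refl (reflexive ∘ ≡.cong T ∘ back-suc a ∘ toℕ)))

mainTheorem14 : {c ℓ : Level} (R : CommutativeRing c ℓ) →
  let open CommutativeRing R in
  (T : ℤ → Carrier) → IsTribonacci R T → (k : ℕ) →
    let K = nat R k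
        sq = λ (r : ℤ) → T r * T r
    in
    nat R 8 * sumSqWeighted R T k
      ≈ (nat R 9 * K * K - nat R 4 * K + nat R 6) * sq (+ k)
        + (nat R 7 * K * K - nat R 14 * K + nat R 7) * sq (+ k ℤ.- + 1)
        + (nat R 4 * K * K - nat R 16 * K + nat R 10) * sq (+ k ℤ.- + 2)
        - (nat R 2 * K * K + nat R 6) * sq (+ k ℤ.- + 3)
        - (K * K + nat R 2) * sq (+ k ℤ.- + 4)
        - (K * K - nat R 2 * K + nat R 3) * sq (+ k ℤ.- + 5)
        - nat R 19 * sq (ℤ.- + 1)
        - nat R 28 * sq (ℤ.- + 2)
        - nat R 30 * sq (ℤ.- + 3)
        + nat R 8 * sq (ℤ.- + 4)
        + nat R 3 * sq (ℤ.- + 5)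
        + nat R 6 * sq (ℤ.- + 6)
mainTheorem14 R T tribonacci k =
  trans (telescoping R T (potential-step R T tribonacci -[1+ 0 ])
                         (potential-step R T tribonacci ∘ +_) k)
        (sym (weightedSquares-at-minus-one R (potential R T (+ k))
                (T (ℤ.- + 1)) (T (ℤ.- + 2)) (T (ℤ.- + 3)) (T (ℤ.- + 4)) (T (ℤ.- + 5)) (T (ℤ.- + 6))))
  where open CommutativeRing R using (trans; sym)
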